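{- Let $q$ be a positive integer and $B_q=(S(m,n;q))_{m,n=1}^q$. For an integer $j$ with $1\le j\le q$ (indices of $u$ taken modulo $q$) let $u_j=(\omega_j,\omega_j^2,\dots,\omega_j^q)^T$ where $\omega_j=\exp(2\pi i j/q)$. Then: (i) if $\gcd(j,q)>1$, then $B_qu_j=0$; (ii) if $\gcd(j,q)=1$ and $j+j^*\equiv 0\pmod q$, then $B_qu_j=qu_j$; (iii) if $\gcd(j,q)=1$ and $j+j^*\not\equiv 0\pmod q$, then $B_q(u_j+u_{ -j^*})=q(u_j+u_{ -j^*})$ and $B_q(u_j-u_{ -j^*})=-q(u_j-u_{ -j^*})$.
   Context: For integers $m,n$, the Kloosterman sum is $S(m,n;q)=\sum_{1\le k\le q,\ \gcd(k,q)=1}\exp\bigl(\frac{2\pi i}{q}(mk+nk^*)\bigr)$, where $k^*$ denotes an inverse of $k$ modulo $q$; similarly $j^*$ is an inverse of $j$ modulo $q$. For any integer $t$, $u_t=(\omega^{t},\omega^{2t},\dots,\omega^{qt})^T$ with $\omega=\exp(2\pi i/q)$, so $u_t$ depends only on $t$ modulo $q$. -}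

module Defs where

open import Level using (Level)
open import Data.Nat as ℕ using (ℕ; zero; suc; NonZero)
open import Data.Nat.Coprimality using (Coprime; coprime?)
open import Data.Integer as ℤ using (ℤ; +_; _%ℕ_)
open import Data.Bool using (if_then_else_)
open import Relation.Nullary using (does)
open import Relation.Binary.PropositionalEquality using (_≡_)
open import Algebra.Bundles using (CommutativeRing)

-- Everything is parameterised by a commutative ring R (standing in for ℂ),
-- an element ω of R (standing in for exp(2πi/q)), and the modulus q > 0.
module Kloosterman {c ℓ : Level} (R : CommutativeRing c ℓ) (ω : CommutativeRing.Carrier R)
                   (q : ℕ) .{{_ : NonZero q}} where
  open CommutativeRing R

  pow : Carrier → ℕ → Carrier
  pow x zero    = 1#
  pow x (suc n) = x * pow x n

  fromℕ : ℕ → Carrier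
  fromℕ zero    = 0#
  fromℕ (suc n) = 1# + fromℕ n

  -- e t = ω^t for an integer t, computed as ω^(t mod q)  (ω^q = 1 is assumed)
  e : ℤ → Carrier
  e t = pow ω (t %ℕ q)

  sum1 : ℕ → (ℕ → Carrier) → Carrier
  sum1 zero    f = 0#
  sum1 (suc n) f = sum1 n f + f (suc n)

  -- "ω is a primitive q-th root of unity" in the sense relevant here:
  -- ω^q = 1 and Σ_{k=1}^{q} ω^{tk} = 0 for every t not divisible by q
  -- (both hold for ω = exp(2πi/q) in ℂ).
  record PrimitiveRoot : Set (c Level.⊔ ℓ) where
    field
      ω^q≈1 : pow ω q ≈ 1#
      orth  : (t : ℕ) → 1 ℕ.≤ t → t ℕ.< q → sum1 q (λ k → pow ω (t ℕ.* k)) ≈ 0#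

  IsInverseChoice : (ℕ → ℕ) → Set
  IsInverseChoice inv = (k : ℕ) → Coprime k q → (k ℕ.* inv k) ℕ.% q ≡ 1 ℕ.% q

  -- vectors in R^q are functions on indices 1..q
  Vector : Set c
  Vector = ℕ → Carrier

  module _ (inv : ℕ → ℕ) where
    S : ℤ → ℤ → Carrier
    S m n = sum1 q (λ k → if does (coprime? k q)
                           then e (m ℤ.* + k ℤ.+ n ℤ.* + inv k)
                           else 0#)

    B : Vector → Vector
    B v m = sum1 q (λ n → S (+ m) (+ n) * v n)

  u : ℤ → Vector
  u t n = e (t ℤ.* + n)

  _+ᵛ_ _-ᵛ_ : Vector → Vector → Vector
  (v +ᵛ w) n = v n + w n
  (v -ᵛ w) n = v n - w n

  _·ᵛ_ : Carrier → Vector → Vector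
  (a ·ᵛ v) n = a * v n

  0ᵛ : Vector
  0ᵛ n = 0#

  _≈ᵛ_ : Vector → Vector → Set ℓ
  v ≈ᵛ w = (n : ℕ) → 1 ℕ.≤ n → n ℕ.≤ q → v n ≈ w n

-- If v n = ω^(a n) on 1..q, summing over n first turns (B v)_m into
-- Σ_{gcd(k,q)=1} ω^(k m) Σ_n ω^((k* + a) n), and by orthogonality only units k with
-- k* ≡ -a survive, each contributing q ω^(k m). Since inverses mod q are unique there is at
-- most one such k: for a = j it exists iff j is a unit and is then -j*, for a = -j* it is j.
-- So B u_j = 0 when gcd(j,q) > 1, and otherwise B swaps u_j and u_{-j*} up to the factor q,
-- which gives (ii) when the two vectors coincide and (iii) for their sum and difference.

module Submission where

open import Defs
open import Level using (Level; 0ℓ)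
open import Data.Nat as ℕ using (ℕ; zero; suc; NonZero; _≤_; _<_; _%_; _∸_; s≤s; z≤n)
open import Data.Nat.Properties
  using (<⇒≤; <⇒≱; <⇒≢; ≤-refl; ≤-pred; ≤∧≢⇒<; m≤n⇒m≤1+n; n≢0⇒n>0; _≟_)
import Data.Nat.Properties as ℕₚ
import Data.Integer.Properties as ℤₚ
open import Data.Nat.DivMod
  using (%-distribˡ-+; %-distribˡ-*; m%n%n≡m%n; m*n%n≡0; n%n≡0; m%n<n; m<n⇒m%n≡m; m≡m%n+[m/n]*n)
open import Data.Nat.Divisibility using (_∣_; m%n≡0⇒n∣m; ∣-trans; ∣m+n∣m⇒∣n; ∣n⇒∣m*n; ∣1⇒≡1)
open import Data.Nat.GCD using (gcd)
open import Data.Nat.Coprimality using (Coprime; coprime?; coprime⇒gcd≡1)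
open import Data.Bool using (if_then_else_)
open import Data.Nat.Tactic.RingSolver using (solve-∀)
open import Data.Integer as ℤ using (+_; _%ℕ_)
open import Data.Product using (_×_; _,_)
open import Data.Empty using (⊥-elim)
open import Function using (_∘_)
open import Relation.Nullary using (¬_; Dec; does; yes; no)
open import Relation.Binary using (Rel; Setoid)
import Relation.Binary.Construct.On as On
import Relation.Binary.Reasoning.Setoid as SetoidReasoning
open import Relation.Binary.PropositionalEquality as P using (_≡_; _≢_)
open import Algebra.Bundles using (CommutativeRing)

module Modular (q : ℕ) .{{_ : NonZero q}} where

  infix 4 _≡ₘ_
  _≡ₘ_ : Rel ℕ 0ℓ
  m ≡ₘ n = m % q ≡ n % q

  ≡ₘ-setoid : Setoid 0ℓ 0ℓ
  ≡ₘ-setoid = On.setoid (P.setoid ℕ) (_% q)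

  open SetoidReasoning ≡ₘ-setoid
  open ℕₚ using (+-comm; +-assoc; +-identityʳ; *-zeroʳ; *-identityˡ; *-identityʳ; *-distribˡ-+; *-distribʳ-+;
                 m+[n∸m]≡n; m∸n≤m; m<n⇒0<n∸m)
  open import Data.Nat using (_+_; _*_)

  0%q≡0 : 0 % q ≡ 0
  0%q≡0 = m*n%n≡0 0 q

  m%q≡ₘm : ∀ m → m % q ≡ₘ m
  m%q≡ₘm m = m%n%n≡m%n m q

  q≡ₘ0 : q ≡ₘ 0
  q≡ₘ0 = P.trans (n%n≡0 q) (P.sym 0%q≡0)

  %≡0⇒≡ₘ0 : ∀ {m} → m % q ≡ 0 → m ≡ₘ 0
  %≡0⇒≡ₘ0 m%q≡0 = P.trans m%q≡0 (P.sym 0%q≡0)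

  ≡ₘ0⇒q∣ : ∀ {m} → m ≡ₘ 0 → q ∣ m
  ≡ₘ0⇒q∣ {m} h = m%n≡0⇒n∣m m q (P.trans h 0%q≡0)

  +-congₘ : ∀ {a b c d} → a ≡ₘ b → c ≡ₘ d → a + c ≡ₘ b + d
  +-congₘ {a} {b} {c} {d} a≡b c≡d = begin
    a + c                  ≈⟨ %-distribˡ-+ a c q ⟩
    a % q + c % q          ≡⟨ P.cong₂ _+_ a≡b c≡d ⟩
    b % q + d % q          ≈⟨ %-distribˡ-+ b d q ⟨
    b + d                  ∎

  *-congₘ : ∀ {a b c d} → a ≡ₘ b → c ≡ₘ d → a * c ≡ₘ b * d
  *-congₘ {a} {b} {c} {d} a≡b c≡d = begin
    a * c                  ≈⟨ %-distribˡ-* a c q ⟩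
    a % q * (c % q)        ≡⟨ P.cong₂ _*_ a≡b c≡d ⟩
    b % q * (d % q)        ≈⟨ %-distribˡ-* b d q ⟨
    b * d                  ∎

  -- The representative of -m in 1..q (q rather than 0), so that it can be a summation index.
  neg : ℕ → ℕ
  neg m = q ∸ m % q

  1≤neg : ∀ m → 1 ≤ neg m
  1≤neg m = m<n⇒0<n∸m (m%n<n m q)

  neg≤q : ∀ m → neg m ≤ q
  neg≤q m = m∸n≤m q (m % q)

  +-negʳ : ∀ m → m + neg m ≡ₘ 0
  +-negʳ m = begin
    m + neg m              ≈⟨ +-congₘ (m%q≡ₘm m) P.refl ⟨
    m % q + (q ∸ m % q)    ≡⟨ m+[n∸m]≡n (<⇒≤ (m%n<n m q)) ⟩
    q                      ≈⟨ q≡ₘ0 ⟩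
    0                      ∎

  +-cancelˡ-≡ₘ : ∀ c {m n} → c + m ≡ₘ c + n → m ≡ₘ n
  +-cancelˡ-≡ₘ c {m} {n} h = begin
    m                      ≈⟨ +-congₘ (+-negʳ c) P.refl ⟨
    (c + neg c) + m        ≡⟨ regroup m ⟩
    neg c + (c + m)        ≈⟨ +-congₘ {neg c} P.refl h ⟩
    neg c + (c + n)        ≡⟨ regroup n ⟨
    (c + neg c) + n        ≈⟨ +-congₘ (+-negʳ c) P.refl ⟩
    n                      ∎
    where
    regroup : ∀ x → (c + neg c) + x ≡ neg c + (c + x)
    regroup x = P.trans (P.cong (_+ x) (+-comm c (neg c))) (+-assoc (neg c) c x)

  +-cancelʳ-≡ₘ : ∀ c {m n} → m + c ≡ₘ n + c → m ≡ₘ n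
  +-cancelʳ-≡ₘ c {m} {n} h = +-cancelˡ-≡ₘ c (begin
    c + m                  ≡⟨ +-comm c m ⟩
    m + c                  ≈⟨ h ⟩
    n + c                  ≡⟨ +-comm n c ⟩
    c + n                  ∎)

  neg-unique : ∀ {m n} → m + n ≡ₘ 0 → n ≡ₘ neg m
  neg-unique {m} h = +-cancelˡ-≡ₘ m (P.trans h (P.sym (+-negʳ m)))

  neg-*ˡ : ∀ m n → neg m * n ≡ₘ neg (m * n)
  neg-*ˡ m n = neg-unique (begin
    m * n + neg m * n      ≡⟨ *-distribʳ-+ n m (neg m) ⟨
    (m + neg m) * n        ≈⟨ *-congₘ (+-negʳ m) P.refl ⟩
    0                      ∎)

  -- The case split follows the definition of _%ℕ_ on negative integers.
  +-[-m]%ℕq≡ₘ0 : ∀ m → m + (ℤ.- (+ m)) %ℕ q ≡ₘ 0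
  +-[-m]%ℕq≡ₘ0 zero = m%q≡ₘm 0
  +-[-m]%ℕq≡ₘ0 (suc m) with suc m % q in r≡
  ... | zero  = P.trans (P.cong (_% q) (+-identityʳ (suc m))) (P.trans r≡ (P.sym 0%q≡0))
  ... | suc r = begin
    suc m + (q ∸ suc r)      ≈⟨ +-congₘ (m%q≡ₘm (suc m)) P.refl ⟨
    suc m % q + (q ∸ suc r)  ≡⟨ P.cong (_+ (q ∸ suc r)) r≡ ⟩
    suc r + (q ∸ suc r)      ≡⟨ m+[n∸m]≡n (<⇒≤ (P.subst (_< q) r≡ (m%n<n (suc m) q))) ⟩
    q                        ≈⟨ q≡ₘ0 ⟩
    0                        ∎

  [-m]%ℕq≡ₘneg : ∀ m → (ℤ.- (+ m)) %ℕ q ≡ₘ neg m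
  [-m]%ℕq≡ₘneg m = neg-unique (+-[-m]%ℕq≡ₘ0 m)

  inverse-injective : ∀ x x′ y y′ → x * x′ ≡ₘ 1 → y * y′ ≡ₘ 1 → x′ ≡ₘ y′ → x ≡ₘ y
  inverse-injective x x′ y y′ xx′≡1 yy′≡1 x′≡y′ = begin
    x                      ≡⟨ *-identityʳ x ⟨
    x * 1                  ≈⟨ *-congₘ {x} P.refl yy′≡1 ⟨
    x * (y * y′)           ≈⟨ *-congₘ {x} P.refl (*-congₘ {y} P.refl x′≡y′) ⟨
    x * (y * x′)           ≡⟨ x[yz]≡y[xz] x y x′ ⟩
    y * (x * x′)           ≈⟨ *-congₘ {y} P.refl xx′≡1 ⟩
    y * 1                  ≡⟨ *-identityʳ y ⟩
    y                      ∎
    where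
    x[yz]≡y[xz] : ∀ x y z → x * (y * z) ≡ y * (x * z)
    x[yz]≡y[xz] = solve-∀

  neg-inverse⇒1+*≡ₘ0 : ∀ x x′ y → x * x′ ≡ₘ 1 → x′ + y ≡ₘ 0 → 1 + x * y ≡ₘ 0
  neg-inverse⇒1+*≡ₘ0 x x′ y xx′≡1 x′+y≡0 = begin
    1 + x * y              ≈⟨ +-congₘ xx′≡1 P.refl ⟨
    x * x′ + x * y         ≡⟨ *-distribˡ-+ x x′ y ⟨
    x * (x′ + y)           ≈⟨ *-congₘ {x} P.refl x′+y≡0 ⟩
    x * 0                  ≡⟨ *-zeroʳ x ⟩
    0                      ∎

  1+*≡ₘ0⇒neg-inverse : ∀ x x′ y → x * x′ ≡ₘ 1 → 1 + x * y ≡ₘ 0 → x′ + y ≡ₘ 0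
  1+*≡ₘ0⇒neg-inverse x x′ y xx′≡1 1+xy≡0 = begin
    x′ + y                 ≡⟨ P.cong (λ t → x′ + t) (*-identityˡ y) ⟨
    x′ + 1 * y             ≈⟨ +-congₘ {x′} P.refl (*-congₘ xx′≡1 P.refl) ⟨
    x′ + x * x′ * y        ≡⟨ factor x x′ y ⟩
    x′ * (1 + x * y)       ≈⟨ *-congₘ {x′} P.refl 1+xy≡0 ⟩
    x′ * 0                 ≡⟨ *-zeroʳ x′ ⟩
    0                      ∎
    where
    factor : ∀ x x′ y → x′ + x * x′ * y ≡ x′ * (1 + x * y)
    factor = solve-∀

  1+*≡ₘ0⇒coprime : ∀ x y → 1 + x * y ≡ₘ 0 → Coprime y q
  1+*≡ₘ0⇒coprime x y 1+xy≡0 {d} (d∣y , d∣q) = ∣1⇒≡1 (∣m+n∣m⇒∣n d∣xy+1 (∣n⇒∣m*n x d∣y))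
    where
    d∣xy+1 : d ∣ x * y + 1
    d∣xy+1 = P.subst (d ∣_) (+-comm 1 (x * y)) (∣-trans d∣q (≡ₘ0⇒q∣ 1+xy≡0))

  ≡ₘ⇒≡ : ∀ {m n} → m < q → n < q → m ≡ₘ n → m ≡ n
  ≡ₘ⇒≡ m<q n<q m≡n = P.trans (P.sym (m<n⇒m%n≡m m<q)) (P.trans m≡n (m<n⇒m%n≡m n<q))

  ≡ₘ⇒≡⁺ : ∀ {m n} → 1 ≤ m → m ≤ q → 1 ≤ n → n ≤ q → m ≡ₘ n → m ≡ n
  ≡ₘ⇒≡⁺ {suc m} {suc n} _ m<q _ n<q 1+m≡1+n = P.cong suc (≡ₘ⇒≡ m<q n<q (+-cancelˡ-≡ₘ 1 1+m≡1+n))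

module SumAndPow {c ℓ : Level} (R : CommutativeRing c ℓ) (ω : CommutativeRing.Carrier R)
                      (q : ℕ) .{{_ : NonZero q}} where
  open CommutativeRing R
  open Kloosterman R ω q
  open import Algebra.Properties.AbelianGroup +-abelianGroup using (⁻¹-∙-comm)
  open import Algebra.Properties.Group +-group using (ε⁻¹≈ε)
  open import Algebra.Properties.CommutativeSemigroup +-commutativeSemigroup using (interchange)

  sum1-cong : ∀ n {f g} → (∀ k → 1 ≤ k → k ≤ n → f k ≈ g k) → sum1 n f ≈ sum1 n g
  sum1-cong zero    f≈g = refl
  sum1-cong (suc n) f≈g =
    +-cong (sum1-cong n (λ k 1≤k k≤n → f≈g k 1≤k (m≤n⇒m≤1+n k≤n))) (f≈g (suc n) (s≤s z≤n) ≤-refl)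

  sum1-zero : ∀ n {f} → (∀ k → 1 ≤ k → k ≤ n → f k ≈ 0#) → sum1 n f ≈ 0#
  sum1-zero zero    f≈0 = refl
  sum1-zero (suc n) f≈0 = trans
    (+-cong (sum1-zero n (λ k 1≤k k≤n → f≈0 k 1≤k (m≤n⇒m≤1+n k≤n))) (f≈0 (suc n) (s≤s z≤n) ≤-refl))
    (+-identityʳ 0#)

  sum1-+ : ∀ n f g → sum1 n (λ k → f k + g k) ≈ sum1 n f + sum1 n g
  sum1-+ zero    f g = sym (+-identityʳ 0#)
  sum1-+ (suc n) f g = trans (+-congʳ (sum1-+ n f g)) (interchange _ _ _ _)

  sum1-neg : ∀ n f → sum1 n (λ k → - f k) ≈ - sum1 n f
  sum1-neg zero    f = sym ε⁻¹≈ε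
  sum1-neg (suc n) f = trans (+-congʳ (sum1-neg n f)) (⁻¹-∙-comm _ _)

  sum1-*ˡ : ∀ n a f → sum1 n (λ k → a * f k) ≈ a * sum1 n f
  sum1-*ˡ zero    a f = sym (zeroʳ a)
  sum1-*ˡ (suc n) a f = trans (+-congʳ (sum1-*ˡ n a f)) (sym (distribˡ a _ _))

  sum1-*ʳ : ∀ n a f → sum1 n (λ k → f k * a) ≈ sum1 n f * a
  sum1-*ʳ zero    a f = sym (zeroˡ a)
  sum1-*ʳ (suc n) a f = trans (+-congʳ (sum1-*ʳ n a f)) (sym (distribʳ a _ _))

  sum1-comm : ∀ m n (F : ℕ → ℕ → Carrier) →
              sum1 m (λ i → sum1 n (λ k → F i k)) ≈ sum1 n (λ k → sum1 m (λ i → F i k))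
  sum1-comm zero    n F = sym (sum1-zero n (λ _ _ _ → refl))
  sum1-comm (suc m) n F =
    trans (+-congʳ (sum1-comm m n F)) (sym (sum1-+ n (λ k → sum1 m (λ i → F i k)) (F (suc m))))

  sum1-1# : ∀ n → sum1 n (λ _ → 1#) ≈ fromℕ n
  sum1-1# zero    = refl
  sum1-1# (suc n) = trans (+-comm _ _) (+-congˡ (sum1-1# n))

  sum1-single : ∀ n {f} k₀ → 1 ≤ k₀ → k₀ ≤ n → (∀ k → 1 ≤ k → k ≤ n → k ≢ k₀ → f k ≈ 0#) →
                sum1 n f ≈ f k₀
  sum1-single zero      k₀ 1≤k₀ k₀≤0 _ = ⊥-elim (<⇒≱ 1≤k₀ k₀≤0)
  sum1-single (suc n) {f} k₀ 1≤k₀ k₀≤1+n f≈0 with k₀ ≟ suc n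
  ... | yes P.refl = trans
    (+-congʳ (sum1-zero n (λ k 1≤k k≤n → f≈0 k 1≤k (m≤n⇒m≤1+n k≤n) (<⇒≢ (s≤s k≤n)))))
    (+-identityˡ _)
  ... | no k₀≢1+n = trans
    (+-cong (sum1-single n k₀ 1≤k₀ (≤-pred (≤∧≢⇒< k₀≤1+n k₀≢1+n))
                         (λ k 1≤k k≤n → f≈0 k 1≤k (m≤n⇒m≤1+n k≤n)))
            (f≈0 (suc n) (s≤s z≤n) ≤-refl (k₀≢1+n ∘ P.sym)))
    (+-identityʳ _)

  pow-+ : ∀ x a b → pow x (a ℕ.+ b) ≈ pow x a * pow x b
  pow-+ x zero    b = sym (*-identityˡ _)
  pow-+ x (suc a) b = trans (*-congˡ (pow-+ x a b)) (sym (*-assoc _ _ _))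

module RootOfUnity {c ℓ : Level} (R : CommutativeRing c ℓ) (ω : CommutativeRing.Carrier R)
                   (q : ℕ) .{{_ : NonZero q}} (pr : Kloosterman.PrimitiveRoot R ω q) where
  open CommutativeRing R
  open Kloosterman R ω q
  open PrimitiveRoot pr
  open Modular q
  open SumAndPow R ω q
  open SetoidReasoning setoid

  pow-*q : ∀ k → pow ω (k ℕ.* q) ≈ 1#
  pow-*q zero    = refl
  pow-*q (suc k) = trans (pow-+ ω q (k ℕ.* q)) (trans (*-cong ω^q≈1 (pow-*q k)) (*-identityˡ 1#))

  pow-% : ∀ a → pow ω (a % q) ≈ pow ω a
  pow-% a = begin
    pow ω (a % q)                          ≈⟨ *-identityʳ _ ⟨
    pow ω (a % q) * 1#                     ≈⟨ *-congˡ (pow-*q (a ℕ./ q)) ⟨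
    pow ω (a % q) * pow ω (a ℕ./ q ℕ.* q)  ≈⟨ pow-+ ω (a % q) (a ℕ./ q ℕ.* q) ⟨
    pow ω (a % q ℕ.+ a ℕ./ q ℕ.* q)        ≡⟨ P.cong (pow ω) (m≡m%n+[m/n]*n a q) ⟨
    pow ω a                                ∎

  pow-cong : ∀ {a b} → a ≡ₘ b → pow ω a ≈ pow ω b
  pow-cong {a} {b} a≡b = trans (sym (pow-% a)) (trans (reflexive (P.cong (pow ω) a≡b)) (pow-% b))

  sum1-pow-≡ₘ0 : ∀ {t} → t ≡ₘ 0 → sum1 q (λ n → pow ω (t ℕ.* n)) ≈ fromℕ q
  sum1-pow-≡ₘ0 {t} t≡0 = trans (sum1-cong q (λ n _ _ → pow-cong (*-congₘ t≡0 P.refl))) (sum1-1# q)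

  sum1-pow-≢ₘ0 : ∀ {t} → ¬ t ≡ₘ 0 → sum1 q (λ n → pow ω (t ℕ.* n)) ≈ 0#
  sum1-pow-≢ₘ0 {t} t≢0 = trans (sum1-cong q (λ n _ _ → pow-cong (*-congₘ (P.sym (m%q≡ₘm t)) P.refl)))
    (orth (t % q) (n≢0⇒n>0 (t≢0 ∘ %≡0⇒≡ₘ0)) (m%n<n t q))

  IsCharacter : ℕ → Vector → Set ℓ
  IsCharacter a v = v ≈ᵛ (λ n → pow ω (a ℕ.* n))

  u-character : ∀ j → IsCharacter j (u (+ j))
  u-character j n _ _ = trans (reflexive (P.cong e (P.sym (ℤₚ.pos-* j n)))) (pow-% (j ℕ.* n))

  u-neg-character : ∀ x → IsCharacter (neg x) (u (ℤ.- (+ x)))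
  u-neg-character x n _ _ = begin
    e (ℤ.- (+ x) ℤ.* + n)      ≡⟨ P.cong e (ℤₚ.neg-distribˡ-* (+ x) (+ n)) ⟨
    e (ℤ.- (+ x ℤ.* + n))      ≡⟨ P.cong (λ t → e (ℤ.- t)) (ℤₚ.pos-* x n) ⟨
    e (ℤ.- (+ (x ℕ.* n)))      ≈⟨ pow-cong (P.trans ([-m]%ℕq≡ₘneg (x ℕ.* n)) (P.sym (neg-*ˡ x n))) ⟩
    pow ω (neg x ℕ.* n)        ∎

  u-neg≈u : ∀ x y → x ℕ.+ y ≡ₘ 0 → u (ℤ.- (+ x)) ≈ᵛ u (+ y)
  u-neg≈u x y x+y≡0 n 1≤n n≤q = begin
    u (ℤ.- (+ x)) n        ≈⟨ u-neg-character x n 1≤n n≤q ⟩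
    pow ω (neg x ℕ.* n)    ≈⟨ pow-cong (*-congₘ (P.sym (neg-unique x+y≡0)) P.refl) ⟩
    pow ω (y ℕ.* n)        ≈⟨ u-character y n 1≤n n≤q ⟨
    u (+ y) n              ∎

  e-kloosterman : ∀ m n k i → e (+ m ℤ.* + k ℤ.+ + n ℤ.* + i) ≈ pow ω (k ℕ.* m) * pow ω (i ℕ.* n)
  e-kloosterman m n k i = begin
    e (+ m ℤ.* + k ℤ.+ + n ℤ.* + i)    ≡⟨ P.cong e (P.cong₂ ℤ._+_ (ℤₚ.pos-* m k) (ℤₚ.pos-* n i)) ⟨
    e (+ (m ℕ.* k) ℤ.+ + (n ℕ.* i))    ≡⟨ P.cong e (ℤₚ.pos-+ (m ℕ.* k) (n ℕ.* i)) ⟨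
    e (+ (m ℕ.* k ℕ.+ n ℕ.* i))        ≈⟨ pow-% (m ℕ.* k ℕ.+ n ℕ.* i) ⟩
    pow ω (m ℕ.* k ℕ.+ n ℕ.* i)        ≡⟨ P.cong₂ (λ s t → pow ω (s ℕ.+ t)) (ℕₚ.*-comm m k) (ℕₚ.*-comm n i) ⟩
    pow ω (k ℕ.* m ℕ.+ i ℕ.* n)        ≈⟨ pow-+ ω (k ℕ.* m) (i ℕ.* n) ⟩
    pow ω (k ℕ.* m) * pow ω (i ℕ.* n)  ∎

module Linearity {c ℓ : Level} (R : CommutativeRing c ℓ) (ω : CommutativeRing.Carrier R)
                 (q : ℕ) .{{_ : NonZero q}} (inv : ℕ → ℕ) where
  open CommutativeRing R
  open Kloosterman R ω q
  open SumAndPow R ω q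
  open import Algebra.Properties.Ring ring using (-‿distribˡ-*; x[y-z]≈xy-xz)
  open import Algebra.Properties.AbelianGroup +-abelianGroup using (⁻¹-anti-homo‿-)
  open SetoidReasoning setoid

  B-+ᵛ : ∀ v w m → B inv (v +ᵛ w) m ≈ B inv v m + B inv w m
  B-+ᵛ v w m = trans (sum1-cong q (λ n _ _ → distribˡ _ _ _)) (sum1-+ q _ _)

  B--ᵛ : ∀ v w m → B inv (v -ᵛ w) m ≈ B inv v m - B inv w m
  B--ᵛ v w m = trans (sum1-cong q (λ n _ _ → x[y-z]≈xy-xz _ _ _)) (trans (sum1-+ q _ _) (+-congˡ (sum1-neg q _)))

  module _ {μ : Carrier} {v w : Vector} (Bv≈μw : B inv v ≈ᵛ (μ ·ᵛ w)) (Bw≈μv : B inv w ≈ᵛ (μ ·ᵛ v)) where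

    B-swap-+ : B inv (v +ᵛ w) ≈ᵛ (μ ·ᵛ (v +ᵛ w))
    B-swap-+ m 1≤m m≤q = begin
      B inv (v +ᵛ w) m         ≈⟨ B-+ᵛ v w m ⟩
      B inv v m + B inv w m    ≈⟨ +-cong (Bv≈μw m 1≤m m≤q) (Bw≈μv m 1≤m m≤q) ⟩
      μ * w m + μ * v m        ≈⟨ +-comm _ _ ⟩
      μ * v m + μ * w m        ≈⟨ distribˡ μ (v m) (w m) ⟨
      μ * (v m + w m)          ∎

    B-swap-- : B inv (v -ᵛ w) ≈ᵛ ((- μ) ·ᵛ (v -ᵛ w))
    B-swap-- m 1≤m m≤q = begin
      B inv (v -ᵛ w) m         ≈⟨ B--ᵛ v w m ⟩
      B inv v m - B inv w m    ≈⟨ +-cong (Bv≈μw m 1≤m m≤q) (-‿cong (Bw≈μv m 1≤m m≤q)) ⟩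
      μ * w m - μ * v m        ≈⟨ ⁻¹-anti-homo‿- (μ * v m) (μ * w m) ⟨
      - (μ * v m - μ * w m)    ≈⟨ -‿cong (x[y-z]≈xy-xz μ (v m) (w m)) ⟨
      - (μ * (v m - w m))      ≈⟨ -‿distribˡ-* μ (v m - w m) ⟩
      - μ * (v m - w m)        ∎

module BOnCharacters {c ℓ : Level} (R : CommutativeRing c ℓ) (ω : CommutativeRing.Carrier R)
                      (q : ℕ) .{{_ : NonZero q}} (pr : Kloosterman.PrimitiveRoot R ω q) (inv : ℕ → ℕ) where
  open CommutativeRing R
  open Kloosterman R ω q
  open Modular q
  open SumAndPow R ω q
  open RootOfUnity R ω q pr
  open SetoidReasoning setoid

  module Expansion (a : ℕ) {v : Vector} (χ : IsCharacter a v) (m : ℕ) where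

    term : (k : ℕ) → Dec (Coprime k q) → Carrier
    term k (yes _) = pow ω (k ℕ.* m) * sum1 q (λ n → pow ω ((inv k ℕ.+ a) ℕ.* n))
    term k (no _)  = 0#

    column : ∀ k (d : Dec (Coprime k q)) →
             sum1 q (λ n → (if does d then e (+ m ℤ.* + k ℤ.+ + n ℤ.* + inv k) else 0#) * v n) ≈ term k d
    column k (no _)  = sum1-zero q (λ n _ _ → zeroˡ (v n))
    column k (yes _) = trans (sum1-cong q factor) (sum1-*ˡ q _ _)
      where
      factor : ∀ n → 1 ≤ n → n ≤ q →
               e (+ m ℤ.* + k ℤ.+ + n ℤ.* + inv k) * v n ≈ pow ω (k ℕ.* m) * pow ω ((inv k ℕ.+ a) ℕ.* n)
      factor n 1≤n n≤q = begin
        e (+ m ℤ.* + k ℤ.+ + n ℤ.* + inv k) * v n                 ≈⟨ *-cong (e-kloosterman m n k (inv k)) (χ n 1≤n n≤q) ⟩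
        pow ω (k ℕ.* m) * pow ω (inv k ℕ.* n) * pow ω (a ℕ.* n)   ≈⟨ *-assoc _ _ _ ⟩
        pow ω (k ℕ.* m) * (pow ω (inv k ℕ.* n) * pow ω (a ℕ.* n)) ≈⟨ *-congˡ (pow-+ ω (inv k ℕ.* n) (a ℕ.* n)) ⟨
        pow ω (k ℕ.* m) * pow ω (inv k ℕ.* n ℕ.+ a ℕ.* n)         ≡⟨ P.cong (λ t → pow ω (k ℕ.* m) * pow ω t)
                                                                              (ℕₚ.*-distribʳ-+ n (inv k) a) ⟨
        pow ω (k ℕ.* m) * pow ω ((inv k ℕ.+ a) ℕ.* n)             ∎

    B≈Σterm : B inv v m ≈ sum1 q (λ k → term k (coprime? k q))
    B≈Σterm = begin
      B inv v m                                           ≈⟨ sum1-cong q (λ n _ _ → sum1-*ʳ q (v n) (G n)) ⟨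
      sum1 q (λ n → sum1 q (λ k → G n k * v n))           ≈⟨ sum1-comm q q (λ n k → G n k * v n) ⟩
      sum1 q (λ k → sum1 q (λ n → G n k * v n))           ≈⟨ sum1-cong q (λ k _ _ → column k (coprime? k q)) ⟩
      sum1 q (λ k → term k (coprime? k q))                ∎
      where
      G : ℕ → ℕ → Carrier
      G n k = if does (coprime? k q) then e (+ m ℤ.* + k ℤ.+ + n ℤ.* + inv k) else 0#

    term≈0 : ∀ k d → (Coprime k q → ¬ inv k ℕ.+ a ≡ₘ 0) → term k d ≈ 0#
    term≈0 k (no _)    _         = refl
    term≈0 k (yes cop) k*+a≢0 = trans (*-congˡ (sum1-pow-≢ₘ0 (k*+a≢0 cop))) (zeroʳ _)

    term≈ : ∀ k d → inv k ℕ.+ a ≡ₘ 0 → Coprime k q → term k d ≈ fromℕ q * pow ω (k ℕ.* m)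
    term≈ k (no ¬cop) _     cop = ⊥-elim (¬cop cop)
    term≈ k (yes _)   k*+a≡0 _  = trans (*-congˡ (sum1-pow-≡ₘ0 k*+a≡0)) (*-comm _ _)

  B-character≈0 : ∀ {a v} → IsCharacter a v →
                  (∀ k → 1 ≤ k → k ≤ q → Coprime k q → ¬ inv k ℕ.+ a ≡ₘ 0) → B inv v ≈ᵛ 0ᵛ
  B-character≈0 {a} χ k*+a≢0 m _ _ =
    trans B≈Σterm (sum1-zero q (λ k 1≤k k≤q → term≈0 k (coprime? k q) (k*+a≢0 k 1≤k k≤q)))
    where open Expansion a χ m

  module Eigenvectors (inverse : IsInverseChoice inv) where

    B-character≈ : ∀ {a v b} → IsCharacter a v → 1 ≤ b → b ≤ q → Coprime b q → inv b ℕ.+ a ≡ₘ 0 →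
                   B inv v ≈ᵛ (fromℕ q ·ᵛ (λ m → pow ω (b ℕ.* m)))
    B-character≈ {a} {v} {b} χ 1≤b b≤q cop-b b*+a≡0 m _ _ = begin
      B inv v m                              ≈⟨ B≈Σterm ⟩
      sum1 q (λ k → term k (coprime? k q))   ≈⟨ sum1-single q b 1≤b b≤q off-b ⟩
      term b (coprime? b q)                  ≈⟨ term≈ b (coprime? b q) b*+a≡0 cop-b ⟩
      fromℕ q * pow ω (b ℕ.* m)              ∎
      where
      open Expansion a χ m
      off-b : ∀ k → 1 ≤ k → k ≤ q → k ≢ b → term k (coprime? k q) ≈ 0#
      off-b k 1≤k k≤q k≢b = term≈0 k (coprime? k q) λ cop-k k*+a≡0 →
        let k*≡b* = +-cancelʳ-≡ₘ a (P.trans k*+a≡0 (P.sym b*+a≡0))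
        in k≢b (≡ₘ⇒≡⁺ 1≤k k≤q 1≤b b≤q
                 (inverse-injective k (inv k) b (inv b) (inverse k cop-k) (inverse b cop-b) k*≡b*))

    B-u≈0 : ∀ j → 1 < gcd j q → B inv (u (+ j)) ≈ᵛ 0ᵛ
    B-u≈0 j gcd>1 = B-character≈0 (u-character j) λ k _ _ cop-k k*+j≡0 →
      let cop-j = 1+*≡ₘ0⇒coprime k j (neg-inverse⇒1+*≡ₘ0 k (inv k) j (inverse k cop-k) k*+j≡0)
      in <⇒≢ gcd>1 (P.sym (coprime⇒gcd≡1 cop-j))

    B-u≈u-neg-inverse : ∀ {j} → Coprime j q → B inv (u (+ j)) ≈ᵛ (fromℕ q ·ᵛ u (ℤ.- (+ inv j)))
    B-u≈u-neg-inverse {j} cop-j m 1≤m m≤q = begin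
      B inv (u (+ j)) m              ≈⟨ B-character≈ (u-character j) (1≤neg (inv j)) (neg≤q (inv j))
                                                      cop-k₀ k₀*+j≡0 m 1≤m m≤q ⟩
      fromℕ q * pow ω (k₀ ℕ.* m)     ≈⟨ *-congˡ (u-neg-character (inv j) m 1≤m m≤q) ⟨
      fromℕ q * u (ℤ.- (+ inv j)) m  ∎
      where
      k₀ : ℕ
      k₀ = neg (inv j)
      1+jk₀≡0 : 1 ℕ.+ j ℕ.* k₀ ≡ₘ 0
      1+jk₀≡0 = neg-inverse⇒1+*≡ₘ0 j (inv j) k₀ (inverse j cop-j) (+-negʳ (inv j))
      cop-k₀ : Coprime k₀ q
      cop-k₀ = 1+*≡ₘ0⇒coprime j k₀ 1+jk₀≡0
      k₀*+j≡0 : inv k₀ ℕ.+ j ≡ₘ 0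
      k₀*+j≡0 = 1+*≡ₘ0⇒neg-inverse k₀ (inv k₀) j (inverse k₀ cop-k₀)
        (P.trans (P.cong (λ t → (1 ℕ.+ t) % q) (ℕₚ.*-comm k₀ j)) 1+jk₀≡0)

    B-u-neg-inverse≈u : ∀ {j} → 1 ≤ j → j ≤ q → Coprime j q →
                        B inv (u (ℤ.- (+ inv j))) ≈ᵛ (fromℕ q ·ᵛ u (+ j))
    B-u-neg-inverse≈u {j} 1≤j j≤q cop-j m 1≤m m≤q = begin
      B inv (u (ℤ.- (+ inv j))) m    ≈⟨ B-character≈ (u-neg-character (inv j)) 1≤j j≤q
                                                      cop-j (+-negʳ (inv j)) m 1≤m m≤q ⟩
      fromℕ q * pow ω (j ℕ.* m)      ≈⟨ *-congˡ (u-character j m 1≤m m≤q) ⟨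
      fromℕ q * u (+ j) m            ∎

open import Data.Nat using (_+_)
open ℤ using (-_)

corollary3 : {c ℓ : Level} (R : CommutativeRing c ℓ) (ω : CommutativeRing.Carrier R)
  (q : ℕ) .{{nz : NonZero q}} → Kloosterman.PrimitiveRoot R ω q →
  (inv : ℕ → ℕ) → Kloosterman.IsInverseChoice R ω q inv →
  (j : ℕ) → 1 ≤ j → j ≤ q →
  (1 < gcd j q →
    Kloosterman._≈ᵛ_ R ω q (Kloosterman.B R ω q inv (Kloosterman.u R ω q (+ j))) (Kloosterman.0ᵛ R ω q))
  × (Coprime j q → (j + inv j) % q ≡ 0 →
    Kloosterman._≈ᵛ_ R ω q (Kloosterman.B R ω q inv (Kloosterman.u R ω q (+ j)))
      (Kloosterman._·ᵛ_ R ω q (Kloosterman.fromℕ R ω q q) (Kloosterman.u R ω q (+ j))))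
  × (Coprime j q → (j + inv j) % q ≢ 0 →
    Kloosterman._≈ᵛ_ R ω q
      (Kloosterman.B R ω q inv (Kloosterman._+ᵛ_ R ω q (Kloosterman.u R ω q (+ j)) (Kloosterman.u R ω q (- (+ inv j)))))
      (Kloosterman._·ᵛ_ R ω q (Kloosterman.fromℕ R ω q q)
        (Kloosterman._+ᵛ_ R ω q (Kloosterman.u R ω q (+ j)) (Kloosterman.u R ω q (- (+ inv j)))))
    × Kloosterman._≈ᵛ_ R ω q
      (Kloosterman.B R ω q inv (Kloosterman._-ᵛ_ R ω q (Kloosterman.u R ω q (+ j)) (Kloosterman.u R ω q (- (+ inv j)))))
      (Kloosterman._·ᵛ_ R ω q (CommutativeRing.-_ R (Kloosterman.fromℕ R ω q q))
        (Kloosterman._-ᵛ_ R ω q (Kloosterman.u R ω q (+ j)) (Kloosterman.u R ω q (- (+ inv j))))))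
corollary3 R ω q pr inv inverse j 1≤j j≤q =
    B-u≈0 j
  , (λ cop-j j+j*≡0 m 1≤m m≤q →
      trans (B-u≈u-neg-inverse cop-j m 1≤m m≤q)
            (*-congˡ (u-neg≈u (inv j) j (j*+j≡ₘ0 j+j*≡0) m 1≤m m≤q)))
  , (λ cop-j _ → B-swap-+ (B-u≈u-neg-inverse cop-j) (B-u-neg-inverse≈u 1≤j j≤q cop-j)
               , B-swap-- (B-u≈u-neg-inverse cop-j) (B-u-neg-inverse≈u 1≤j j≤q cop-j))
  where
  open CommutativeRing R using (trans; *-congˡ)
  open Modular q using (_≡ₘ_; %≡0⇒≡ₘ0)
  open RootOfUnity R ω q pr using (u-neg≈u)
  open Linearity R ω q inv using (B-swap-+; B-swap--)
  open BOnCharacters.Eigenvectors R ω q pr inv inverse using (B-u≈0; B-u≈u-neg-inverse; B-u-neg-inverse≈u)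
  j*+j≡ₘ0 : (j + inv j) % q ≡ 0 → inv j + j ≡ₘ 0
  j*+j≡ₘ0 j+j*≡0 = P.trans (P.cong (_% q) (ℕₚ.+-comm (inv j) j)) (%≡0⇒≡ₘ0 j+j*≡0)
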